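{- In an HFP-code $(C,\cdot)$, the all-one vector $\mathbf 1$ is a central involution of the group $(C,\cdot)$: $a\cdot\mathbf 1=\mathbf 1\cdot a$ for all $a\in C$ and $\mathbf 1\cdot\mathbf 1=\mathbf 0$.
   Context: Let $\mathbb{F}=\mathbb{Z}_2$. $\mathbf 0,\mathbf 1$ denote the all-zero and all-one vectors; for a permutation $\pi$ of $\{1,\dots,m\}$ and $v\in\mathbb{F}^m$, $\pi(v)=(v_{\pi^{ -1}(1)},\dots,v_{\pi^{ -1}(m)})$. A binary Hadamard matrix of order $4n$ is obtained from a $4n\times4n$ matrix with entries $\pm1$ and $HH^T=4nI$ by replacing $+1$ by $0$ and $-1$ by $1$; the binary Hadamard code it defines is the set of its rows together with their complements. A code $C\subseteq\mathbb{F}^m$ with $\mathbf 0\in C$ is propelinear if to each $x\in C$ a coordinate permutation $\pi_x$ is assigned such that for all $x,y\in C$: $x+\pi_x(y)\in C$ and $\pi_x\pi_y=\pi_{x+\pi_x(y)}$; then $x\cdot y:=x+\pi_x(y)$ makes $(C,\cdot)$ a group with identity $\mathbf 0$. An HFP-code of length $4n$ is a propelinear code that is also a binary Hadamard code of length $4n$, with $\pi_{\mathbf 0}=\pi_{\mathbf 1}=\mathrm{id}$ and such that for every $a\in C\setminus\{\mathbf 0,\mathbf 1\}$, $\pi_a$ has no fixed coordinate. -}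

module Defs where

open import Data.Nat using (ℕ; zero; suc; _*_)
open import Data.Integer as ℤ using (ℤ; +_; -[1+_])
open import Data.Bool using (Bool; true; false; not; _xor_)
open import Data.Fin using (Fin; zero; suc)
open import Data.Fin.Permutation using (Permutation′; _⟨$⟩ʳ_; _⟨$⟩ˡ_)
open import Data.Vec using (Vec; lookup; tabulate; replicate; map)
open import Data.Product using (Σ; ∃; _×_; _,_)
open import Data.Sum using (_⊎_)
open import Relation.Binary.PropositionalEquality using (_≡_; _≢_)
open import Relation.Nullary using (¬_)
open import Data.Empty using (⊥)

-- Binary vectors of length m over 𝔽 = ℤ₂ (false = 0, true = 1)
Word : ℕ → Set
Word m = Vec Bool m

𝟎 : ∀ {m} → Word m
𝟎 = replicate _ false

𝟏 : ∀ {m} → Word m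
𝟏 = replicate _ true

_⊕_ : ∀ {m} → Word m → Word m → Word m
x ⊕ y = tabulate (λ i → lookup x i xor lookup y i)

compl : ∀ {m} → Word m → Word m
compl = map not

act : ∀ {m} → Permutation′ m → Word m → Word m
act π v = tabulate (λ i → lookup v (π ⟨$⟩ˡ i))

Σℤ : ∀ n → (Fin n → ℤ) → ℤ
Σℤ zero    f = + 0
Σℤ (suc n) f = f zero ℤ.+ Σℤ n (λ i → f (suc i))

sgn : Bool → ℤ
sgn false = + 1
sgn true  = -[1+ 0 ]

-- a binary matrix B (rows B i) is a binary Hadamard matrix of order m:
-- its ±1 version H satisfies H Hᵀ = m I
IsBinaryHadamardMatrix : ∀ m → (Fin m → Word m) → Set
IsBinaryHadamardMatrix m B =
  ∀ i j → Σℤ m (λ k → sgn (lookup (B i) k) ℤ.* sgn (lookup (B j) k))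
          ≡ (if-eq i j)
  where
  open import Data.Fin using (_≟_)
  open import Relation.Nullary using (yes; no)
  if-eq : Fin m → Fin m → ℤ
  if-eq i j with i ≟ j
  ... | yes _ = + m
  ... | no  _ = + 0

IsBinaryHadamardCode : ∀ m → (Word m → Set) → Set
IsBinaryHadamardCode m C =
  Σ (Fin m → Word m) λ B → IsBinaryHadamardMatrix m B ×
    (∀ x → C x → ∃ λ i → x ≡ B i ⊎ x ≡ compl (B i)) ×
    (∀ i → C (B i) × C (compl (B i)))

-- propelinear structure: π assigns a permutation to each vector (only values on C matter)
IsPropelinear : ∀ m → (Word m → Set) → (Word m → Permutation′ m) → Set
IsPropelinear m C π =
  C 𝟎 ×
  (∀ x y → C x → C y → C (x ⊕ act (π x) y)) ×
  (∀ x y → C x → C y → ∀ i →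
      π x ⟨$⟩ʳ (π y ⟨$⟩ʳ i) ≡ π (x ⊕ act (π x) y) ⟨$⟩ʳ i)

mul : ∀ {m} → (Word m → Permutation′ m) → Word m → Word m → Word m
mul π x y = x ⊕ act (π x) y

IsHFPCode : ∀ n → (Word (4 * n) → Set) → (Word (4 * n) → Permutation′ (4 * n)) → Set
IsHFPCode n C π =
  IsPropelinear (4 * n) C π ×
  IsBinaryHadamardCode (4 * n) C ×
  (∀ i → π 𝟎 ⟨$⟩ʳ i ≡ i) ×
  (∀ i → π 𝟏 ⟨$⟩ʳ i ≡ i) ×
  (∀ a → C a → a ≢ 𝟎 → a ≢ 𝟏 → ∀ i → π a ⟨$⟩ʳ i ≢ i)

module Submission where

open import Defs
open import Data.Nat using (ℕ; _*_)
open import Data.Fin using (Fin)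
open import Data.Fin.Permutation using (Permutation′; _⟨$⟩ʳ_; _⟨$⟩ˡ_; inverseʳ)
open import Data.Product using (_×_; _,_)
open import Data.Bool using (Bool; true; false)
open import Data.Bool.Properties using (xor-comm; xor-same)
open import Data.Vec using (lookup; tabulate)
open import Data.Vec.Properties using (lookup-replicate; tabulate-cong; tabulate∘lookup)
open import Relation.Binary.PropositionalEquality using (_≡_; sym; trans; cong; module ≡-Reasoning)

-- The theorem only uses π 𝟏 = id: every permutation fixes 𝟏, and 𝔽^m is an
-- elementary abelian 2-group, so a · 𝟏 = a + 𝟏 = 𝟏 + a = 𝟏 · a and 𝟏 · 𝟏 = 𝟏 + 𝟏 = 𝟎.

tabulate-≗-lookup : ∀ {m} {f : Fin m → Bool} (v : Word m) → (∀ i → f i ≡ lookup v i) → tabulate f ≡ v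
tabulate-≗-lookup v f≗v = trans (tabulate-cong f≗v) (tabulate∘lookup v)

⊕-comm : ∀ {m} (x y : Word m) → x ⊕ y ≡ y ⊕ x
⊕-comm x y = tabulate-cong λ i → xor-comm (lookup x i) (lookup y i)

⊕-self : ∀ {m} (x : Word m) → x ⊕ x ≡ 𝟎
⊕-self x = tabulate-≗-lookup 𝟎 λ i → trans (xor-same (lookup x i)) (sym (lookup-replicate i false))

act-𝟏 : ∀ {m} (p : Permutation′ m) → act p 𝟏 ≡ 𝟏
act-𝟏 p = tabulate-≗-lookup 𝟏 λ i → trans (lookup-replicate (p ⟨$⟩ˡ i) true) (sym (lookup-replicate i true))

act-id : ∀ {m} (p : Permutation′ m) → (∀ i → p ⟨$⟩ʳ i ≡ i) → ∀ v → act p v ≡ v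
act-id p fixes v = tabulate-≗-lookup v λ i → cong (lookup v) (inverse-fixes i)
  where
  inverse-fixes : ∀ i → p ⟨$⟩ˡ i ≡ i
  inverse-fixes i = trans (sym (fixes (p ⟨$⟩ˡ i))) (inverseʳ p)

lemma1 : ∀ (n : ℕ) (C : Word (4 * n) → Set) (π : Word (4 * n) → Permutation′ (4 * n)) →
         IsHFPCode n C π →
         (∀ a → C a → mul π a 𝟏 ≡ mul π 𝟏 a) × (mul π 𝟏 𝟏 ≡ 𝟎)
lemma1 n C π (_ , _ , _ , π𝟏-id , _) = 𝟏-central , 𝟏-involution
  where
  open ≡-Reasoning

  𝟏-central : ∀ a → C a → mul π a 𝟏 ≡ mul π 𝟏 a
  𝟏-central a _ = begin
    a ⊕ act (π a) 𝟏  ≡⟨ cong (a ⊕_) (act-𝟏 (π a)) ⟩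
    a ⊕ 𝟏            ≡⟨ ⊕-comm a 𝟏 ⟩
    𝟏 ⊕ a            ≡⟨ cong (𝟏 ⊕_) (sym (act-id (π 𝟏) π𝟏-id a)) ⟩
    𝟏 ⊕ act (π 𝟏) a  ∎

  𝟏-involution : mul π 𝟏 𝟏 ≡ 𝟎
  𝟏-involution = begin
    𝟏 ⊕ act (π 𝟏) 𝟏  ≡⟨ cong (𝟏 ⊕_) (act-𝟏 (π 𝟏)) ⟩
    𝟏 ⊕ 𝟏            ≡⟨ ⊕-self 𝟏 ⟩
    𝟎                ∎
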